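{- Let $\mathcal{X}$ and $\mathcal{X}'$ be $n$-premaniplexes and let $(\mathcal{Y},\eta)$ be an $(n,m)$-voltage operator. If $\mathcal{X}$ covers $\mathcal{X}'$, then $\mathcal{X}\rtimes_\eta\mathcal{Y}$ covers $\mathcal{X}'\rtimes_\eta\mathcal{Y}$. In particular, if $\Gamma\le\mathrm{Aut}(\mathcal{X})$ and $\mathcal{X}'=\mathcal{X}/\Gamma$, then \[\mathcal{X}'\rtimes_\eta\mathcal{Y}\cong(\mathcal{X}/\Gamma)\rtimes_\eta\mathcal{Y}\cong(\mathcal{X}\rtimes_\eta\mathcal{Y})/\Gamma,\] where $\Gamma$ acts on $\mathcal{X}\rtimes_\eta\mathcal{Y}$ by $(x,y)\gamma=(x\gamma,y)$.
   Context: Graphs may have semiedges and parallel edges. An $n$-premaniplex is a graph whose darts are colored by $\{0,\dots,n-1\}$ (a dart and its inverse have the same color) such that every vertex is the starting point of exactly one dart of each color, and for $|i-j|\ge 2$ every path of length 4 alternating colors $i,j$ is closed. For a vertex $x$, ${}^i x$ denotes the dart of color $i$ starting at $x$, and $x^i$ its endpoint. A homomorphism of $n$-premaniplexes is a map on vertices preserving $i$-adjacency for every $i$; a covering is a surjective homomorphism, and $\mathcal X$ covers $\mathcal X'$ if there is a covering $\mathcal X\to\mathcal X'$. Automorphisms act on the right. For $\Gamma\le\mathrm{Aut}(\mathcal X)$, the quotient $\mathcal X/\Gamma$ is the premaniplex whose vertices are the orbits $x\Gamma$, with $(x\Gamma)^i=(x^i)\Gamma$. The group $\mathrm{Mon}(\mathcal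 U^n)=\langle r_0,\dots,r_{n-1}\mid r_i^2=1,\ (r_ir_j)^2=1 \text{ for } |i-j|\ge2\rangle$ acts on the left on the vertex set of every $n$-premaniplex by $r_i x=x^i$. A voltage assignment $\eta$ with group $G$ assigns $\eta(d)\in G$ to each dart $d$ with $\eta(d^{ -1})=\eta(d)^{ -1}$; the voltage of a path $d_1\cdots d_k$ is $\eta(d_k)\cdots\eta(d_1)$. An $(n,m)$-voltage operator is a pair $(\mathcal Y,\eta)$ with $\mathcal Y$ an $m$-premaniplex and $\eta$ a voltage assignment with group $\mathrm{Mon}(\mathcal U^n)$ such that every length-4 path alternating between colors $i,j$ with $|i-j|\ge2$ has trivial voltage. For an $n$-premaniplex $\mathcal X$, $\mathcal X\rtimes_\eta\mathcal Y$ is the $m$-premaniplex on $V(\mathcal X)\times V(\mathcal Y)$ where for each color $i$ there is an edge of color $i$ joining $(x,y)$ and $(\eta({}^i y)x,\ y^i)$; every $\gamma\in\mathrm{Aut}(\mathcal X)$ induces the automorphism $(x,y)\mapsto(x\gamma,y)$ of it. -}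

module Defs where

open import Data.Nat using (ℕ; _≤_; ∣_-_∣)
open import Data.Nat.Properties using (∣-∣-comm)
open import Data.Fin using (Fin; toℕ)
open import Data.List using (List; []; _∷_; _++_; reverse)
open import Data.Product using (Σ; _×_; _,_; proj₁; proj₂)
open import Relation.Binary using (IsEquivalence)
open import Relation.Binary.PropositionalEquality as P using (_≡_)

Far : ∀ {n} → Fin n → Fin n → Set
Far i j = 2 ≤ ∣ toℕ i - toℕ j ∣

Far-sym : ∀ {n} {i j : Fin n} → Far i j → Far j i
Far-sym {i = i} {j} p = P.subst (2 ≤_) (∣-∣-comm (toℕ i) (toℕ j)) p

-- n-colored graphs in which every vertex has exactly one dart of each
-- color.  Such a graph is the same as a vertex set with, for every
-- color i, the map x ↦ x^i (endpoint of the i-dart at x).  Vertex sets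
-- are setoids (needed for quotients).

record ColoredGraph (n : ℕ) : Set₁ where
  field
    V       : Set
    _≈_     : V → V → Set
    isEquiv : IsEquivalence _≈_
    r       : Fin n → V → V
    r-cong  : ∀ i {x y} → x ≈ y → r i x ≈ r i y
  open IsEquivalence isEquiv public
    renaming (refl to ≈-refl; sym to ≈-sym; trans to ≈-trans)

open ColoredGraph

-- n-premaniplex: (x^i)^i = x (a dart and its inverse have the same
-- color; semiedges are the fixed points), and every alternating
-- i,j path of length 4 with |i-j| ≥ 2 is closed.
record Premaniplex (n : ℕ) : Set₁ where
  field
    graph : ColoredGraph n
  module G = ColoredGraph graph
  field
    invol : ∀ i x → G.r i (G.r i x) G.≈ x
    comm  : ∀ i j → Far i j → ∀ x → G.r j (G.r i (G.r j (G.r i x))) G.≈ x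

open Premaniplex

record Hom {n} (A B : ColoredGraph n) : Set where
  field
    f      : V A → V B
    f-cong : ∀ {x y} → _≈_ A x y → _≈_ B (f x) (f y)
    f-r    : ∀ i x → _≈_ B (f (r A i x)) (r B i (f x))

record Covering {n} (A B : ColoredGraph n) : Set where
  field
    hom  : Hom A B
    surj : ∀ b → Σ (V A) λ a → _≈_ B (Hom.f hom a) b

Covers : ∀ {n} → ColoredGraph n → ColoredGraph n → Set
Covers A B = Covering A B

infix 4 _≅_
record _≅_ {n} (A B : ColoredGraph n) : Set where
  field
    hom     : Hom A B
    g       : V B → V A
    g-cong  : ∀ {x y} → _≈_ B x y → _≈_ A (g x) (g y)
    f∘g     : ∀ b → _≈_ B (Hom.f hom (g b)) b
    g∘f     : ∀ a → _≈_ A (g (Hom.f hom a)) a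

Aut : ∀ {n} → ColoredGraph n → Set
Aut G = G ≅ G

_·_ : ∀ {n} {G : ColoredGraph n} → V G → Aut G → V G
x · γ = Hom.f (_≅_.hom γ) x

module _ {n} {G : ColoredGraph n} where
  private
    _≈G_ = _≈_ G

  idAut : Aut G
  idAut = record
    { hom = record { f = λ x → x ; f-cong = λ p → p ; f-r = λ i x → ≈-refl G }
    ; g = λ x → x ; g-cong = λ p → p ; f∘g = λ _ → ≈-refl G ; g∘f = λ _ → ≈-refl G }

  -- product in Aut G with right action: x (γ δ) = (x γ) δ
  _∘A_ : Aut G → Aut G → Aut G
  γ ∘A δ = record
    { hom = record
      { f = λ x → F₂ (F₁ x)
      ; f-cong = λ p → Hom.f-cong (_≅_.hom δ) (Hom.f-cong (_≅_.hom γ) p)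
      ; f-r = λ i x → ≈-trans G (Hom.f-cong (_≅_.hom δ) (Hom.f-r (_≅_.hom γ) i x))
                                  (Hom.f-r (_≅_.hom δ) i (F₁ x)) }
    ; g = λ x → _≅_.g γ (_≅_.g δ x)
    ; g-cong = λ p → _≅_.g-cong γ (_≅_.g-cong δ p)
    ; f∘g = λ b → ≈-trans G (Hom.f-cong (_≅_.hom δ) (_≅_.f∘g γ (_≅_.g δ b))) (_≅_.f∘g δ b)
    ; g∘f = λ a → ≈-trans G (_≅_.g-cong γ (_≅_.g∘f δ (F₁ a))) (_≅_.g∘f γ a) }
    where
      F₁ = Hom.f (_≅_.hom γ)
      F₂ = Hom.f (_≅_.hom δ)

  invAut : Aut G → Aut G
  invAut γ = record
    { hom = record
      { f = g
      ; f-cong = _≅_.g-cong γ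
      ; f-r = λ i x → ≈-trans G
                (g-cong (r-cong G i (≈-sym G (f∘g x))))
                (≈-trans G (g-cong (≈-sym G (Hom.f-r (_≅_.hom γ) i (g x))))
                           (g∘f (r G i (g x)))) }
    ; g = F ; g-cong = Hom.f-cong (_≅_.hom γ)
    ; f∘g = g∘f ; g∘f = f∘g }
    where
      open _≅_ γ
      F = Hom.f (_≅_.hom γ)

record IsSubgroup {n} {G : ColoredGraph n} (Γ : Aut G → Set) : Set where
  field
    has-id  : Γ idAut
    has-mul : ∀ {γ δ} → Γ γ → Γ δ → Γ (γ ∘A δ)
    has-inv : ∀ {γ} → Γ γ → Γ (invAut γ)

-- Quotients G/Γ: vertices are orbits xΓ, (xΓ)^i = (x^i)Γ.
-- Represented on the same carrier with the orbit relation as equality.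

module _ {n} (G : ColoredGraph n) (Γ : Aut G → Set) (sg : IsSubgroup Γ) where
  open IsSubgroup sg

  SameOrbit : V G → V G → Set
  SameOrbit x y = Σ (Aut G) λ γ → Γ γ × _≈_ G (x · γ) y

  quotientGraph : ColoredGraph n
  quotientGraph = record
    { V = V G
    ; _≈_ = SameOrbit
    ; isEquiv = record
      { refl = idAut , has-id , ≈-refl G
      ; sym = λ { (γ , p , q) → invAut γ , has-inv p ,
               ≈-trans G (_≅_.g-cong γ (≈-sym G q)) (_≅_.g∘f γ _) }
      ; trans = λ { (γ , p , q) (δ , p' , q') → (γ ∘A δ) , has-mul p p' ,
               ≈-trans G (Hom.f-cong (_≅_.hom δ) q) q' } }
    ; r = r G
    ; r-cong = λ i → λ { (γ , p , q) → γ , p ,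
               ≈-trans G (Hom.f-r (_≅_.hom γ) i _) (r-cong G i q) } }

infix 8 _/_∶_
_/_∶_ : ∀ {n} (X : Premaniplex n) (Γ : Aut (graph X) → Set) → IsSubgroup Γ → Premaniplex n
X / Γ ∶ sg = record
  { graph = quotientGraph (graph X) Γ sg
  ; invol = λ i x → idAut , IsSubgroup.has-id sg , invol X i x
  ; comm = λ i j f x → idAut , IsSubgroup.has-id sg , comm X i j f x }

-- Mon(U^n) = ⟨ r_0 … r_{n-1} | r_i² , (r_i r_j)² for |i-j| ≥ 2 ⟩,
-- presented as words modulo the congruence generated by the relations.
-- The word i₁ ∷ … ∷ i_k stands for r_{i₁} ⋯ r_{i_k}.

Word : ℕ → Set
Word n = List (Fin n)

infix 4 _∼_
data _∼_ {n} : Word n → Word n → Set where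
  ∼refl  : ∀ {w} → w ∼ w
  ∼sym   : ∀ {w v} → w ∼ v → v ∼ w
  ∼trans : ∀ {w v u} → w ∼ v → v ∼ u → w ∼ u
  ∼cong  : ∀ {w w' v v'} → w ∼ w' → v ∼ v' → w ++ v ∼ w' ++ v'
  ∼invol : ∀ i → i ∷ i ∷ [] ∼ []
  ∼comm  : ∀ i j → Far i j → i ∷ j ∷ i ∷ j ∷ [] ∼ []

-- group inverse in Mon(U^n) (generators are involutions)
winv : ∀ {n} → Word n → Word n
winv = reverse

act : ∀ {n} (X : Premaniplex n) → Word n → V (graph X) → V (graph X)
act X []      x = x
act X (i ∷ w) x = r (graph X) i (act X w x)

module _ {n} (X : Premaniplex n) where
  private
    G = graph X

  act-cong : ∀ w {x y} → _≈_ G x y → _≈_ G (act X w x) (act X w y)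
  act-cong []      p = p
  act-cong (i ∷ w) p = r-cong G i (act-cong w p)

  act-++ : ∀ w v x → act X (w ++ v) x ≡ act X w (act X v x)
  act-++ []      v x = P.refl
  act-++ (i ∷ w) v x = P.cong (r G i) (act-++ w v x)

  act-resp : ∀ {w v} → w ∼ v → ∀ x → _≈_ G (act X w x) (act X v x)
  act-resp ∼refl x = ≈-refl G
  act-resp (∼sym p) x = ≈-sym G (act-resp p x)
  act-resp (∼trans p q) x = ≈-trans G (act-resp p x) (act-resp q x)
  act-resp (∼cong {w} {w'} {v} {v'} p q) x =
    P.subst (λ z → _≈_ G z (act X (w' ++ v') x)) (P.sym (act-++ w v x))
      (P.subst (λ z → _≈_ G (act X w (act X v x)) z) (P.sym (act-++ w' v' x))
        (≈-trans G (act-cong w (act-resp q x)) (act-resp p (act X v' x))))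
  act-resp (∼invol i) x = invol X i x
  act-resp (∼comm i j f) x = comm X j i (Far-sym {i = i} {j} f) x

  act-aut : ∀ (γ : Aut G) w x → _≈_ G (act X w x · γ) (act X w (x · γ))
  act-aut γ []      x = ≈-refl G
  act-aut γ (i ∷ w) x =
    ≈-trans G (Hom.f-r (_≅_.hom γ) i (act X w x)) (r-cong G i (act-aut γ w x))

-- (n,m)-voltage operators.  η y i is the voltage of the dart ^i y.
-- The voltage of a path d₁⋯d_k is η(d_k)⋯η(d₁).

record VoltageOperator (n m : ℕ) : Set₁ where
  field
    Y      : Premaniplex m
  open ColoredGraph (graph Y) renaming (V to VY; _≈_ to _≈Y_; r to rY)
  field
    η      : VY → Fin m → Word n
    η-cong : ∀ i {y y'} → y ≈Y y' → η y i ∼ η y' i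
    -- η(d⁻¹) = η(d)⁻¹ ; the inverse of ^i y is ^i (y^i)
    η-inv  : ∀ i y → η (rY i y) i ∼ winv (η y i)
    η-comm : ∀ i j → Far i j → ∀ y →
      η (rY i (rY j (rY i y))) j ++ η (rY j (rY i y)) i ++ η (rY i y) j ++ η y i ∼ []

module _ {n m} (X : Premaniplex n) (O : VoltageOperator n m) where
  open VoltageOperator O
  private
    GX = graph X
    GY = graph Y

  infix 4 _≈P_
  _≈P_ : V GX × V GY → V GX × V GY → Set
  (x , y) ≈P (x' , y') = _≈_ GX x x' × _≈_ GY y y'

  semidirect : ColoredGraph m
  semidirect = record
    { V = V GX × V GY
    ; _≈_ = _≈P_
    ; isEquiv = record
      { refl = ≈-refl GX , ≈-refl GY
      ; sym = λ { (p , q) → ≈-sym GX p , ≈-sym GY q }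
      ; trans = λ { (p , q) (p' , q') → ≈-trans GX p p' , ≈-trans GY q q' } }
    ; r = λ i → λ { (x , y) → act X (η y i) x , r GY i y }
    ; r-cong = λ i → λ { {x , y} {x' , y'} (p , q) →
        ≈-trans GX (act-cong X (η y i) p) (act-resp X (η-cong i q) x') ,
        r-cong GY i q } }

  liftAut : Aut GX → Aut semidirect
  liftAut γ = record
    { hom = record
      { f = λ { (x , y) → x · γ , y }
      ; f-cong = λ { (p , q) → Hom.f-cong (_≅_.hom γ) p , q }
      ; f-r = λ i → λ { (x , y) → act-aut X γ (η y i) x , ≈-refl GY } }
    ; g = λ { (x , y) → _≅_.g γ x , y }
    ; g-cong = λ { (p , q) → _≅_.g-cong γ p , q }
    ; f∘g = λ { (x , y) → _≅_.f∘g γ x , ≈-refl GY }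
    ; g∘f = λ { (x , y) → _≅_.g∘f γ x , ≈-refl GY } }

  liftSub : (Aut GX → Set) → Aut semidirect → Set
  liftSub Γ δ = Σ (Aut GX) λ γ → Γ γ × (∀ p → (p · δ) ≈P (p · liftAut γ))

  liftSub-isSubgroup : ∀ {Γ} → IsSubgroup Γ → IsSubgroup (liftSub Γ)
  liftSub-isSubgroup {Γ} sg = record
    { has-id = idAut , has-id , (λ _ → ≈-refl GX , ≈-refl GY)
    ; has-mul = λ { {δ₁} {δ₂} (γ₁ , p₁ , e₁) (γ₂ , p₂ , e₂) →
        (γ₁ ∘A γ₂) , has-mul p₁ p₂ ,
        (λ q → ≈-trans S (Hom.f-cong (_≅_.hom δ₂) (e₁ q)) (e₂ (q · liftAut γ₁))) }
    ; has-inv = λ { {δ} (γ , p , e) → invAut γ , has-inv p ,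
        (λ q → ≈-trans S
           (_≅_.g-cong δ (≈-sym S (_≅_.f∘g (liftAut γ) q)))
           (≈-trans S (_≅_.g-cong δ (≈-sym S (e (_≅_.g (liftAut γ) q))))
                      (_≅_.g∘f δ (_≅_.g (liftAut γ) q)))) } }
    where
      open IsSubgroup sg
      S = semidirect

infixl 6 _⋊_
_⋊_ : ∀ {n m} → Premaniplex n → VoltageOperator n m → ColoredGraph m
X ⋊ O = semidirect X O

quotient⋊ : ∀ {n m} (X : Premaniplex n) (O : VoltageOperator n m)
  (Γ : Aut (graph X) → Set) → IsSubgroup Γ → ColoredGraph m
quotient⋊ X O Γ sg =
  quotientGraph (X ⋊ O) (liftSub X O Γ) (liftSub-isSubgroup X O sg)

-- Everything is coordinatewise.  A homomorphism h : X → X' commutes with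
-- the left action of Mon(Uⁿ), so (x , y) ↦ (h x , y) respects the edges
-- (x , y) ~ (η(ⁱy) x , yⁱ); it is onto (resp. invertible) when h is.
-- For the quotient, (X/Γ) ⋊ Y and (X ⋊ Y)/Γ have the same vertices and
-- the same edges, and both identify (x , y) with (x' , y') exactly when
-- x' ∈ xΓ and y ≈ y', so the identity map is an isomorphism.
{-# OPTIONS --safe #-}
module Submission where

open import Defs
open import Data.Product using (_×_; _,_)
open import Relation.Binary.PropositionalEquality using (_≡_; refl; cong; subst)
open import Data.List using (_∷_; [])

open ColoredGraph
open Premaniplex

module _ {n} {A B : Premaniplex n} (h : Hom (graph A) (graph B)) where

  act-hom : ∀ w x → _≈_ (graph B) (Hom.f h (act A w x)) (act B w (Hom.f h x))
  act-hom []      x = ≈-refl (graph B)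
  act-hom (i ∷ w) x =
    ≈-trans (graph B) (Hom.f-r h i (act A w x)) (r-cong (graph B) i (act-hom w x))

module _ {n m} {A B : Premaniplex n} (O : VoltageOperator n m) where
  open VoltageOperator O using (Y; η)

  ⋊-hom : Hom (graph A) (graph B) → Hom (A ⋊ O) (B ⋊ O)
  ⋊-hom h = record
    { f      = λ { (x , y) → Hom.f h x , y }
    ; f-cong = λ { (p , q) → Hom.f-cong h p , q }
    ; f-r    = λ i → λ { (x , y) → act-hom h (η y i) x , ≈-refl (graph Y) } }

  ⋊-covering : Covering (graph A) (graph B) → Covering (A ⋊ O) (B ⋊ O)
  ⋊-covering c = record
    { hom  = ⋊-hom (Covering.hom c)
    ; surj = λ { (b , y) → let (a , fa≈b) = Covering.surj c b in
                           (a , y) , fa≈b , ≈-refl (graph Y) } }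

  ⋊-≅ : graph A ≅ graph B → A ⋊ O ≅ B ⋊ O
  ⋊-≅ e = record
    { hom    = ⋊-hom (_≅_.hom e)
    ; g      = λ { (x , y) → _≅_.g e x , y }
    ; g-cong = λ { (p , q) → _≅_.g-cong e p , q }
    ; f∘g    = λ { (x , y) → _≅_.f∘g e x , ≈-refl (graph Y) }
    ; g∘f    = λ { (x , y) → _≅_.g∘f e x , ≈-refl (graph Y) } }

module _ {n m} (X : Premaniplex n) (O : VoltageOperator n m)
         (Γ : Aut (graph X) → Set) (sg : IsSubgroup Γ) where
  open VoltageOperator O using (Y; η)
  open IsSubgroup sg using (has-id)
  private
    GX = graph X
    GY = graph Y

  act-quotient : ∀ w x → act (X / Γ ∶ sg) w x ≡ act X w x
  act-quotient []      x = refl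
  act-quotient (i ∷ w) x = cong (r GX i) (act-quotient w x)

  liftAut∈liftSub : ∀ {γ} → Γ γ → liftSub X O Γ (liftAut X O γ)
  liftAut∈liftSub {γ} γ∈Γ = γ , γ∈Γ , λ _ → ≈-refl GX , ≈-refl GY

  ≈⇒sameOrbit : ∀ {p q} → _≈P_ X O p q → _≈_ (quotient⋊ X O Γ sg) p q
  ≈⇒sameOrbit p≈q = liftAut X O idAut , liftAut∈liftSub has-id , p≈q

  quotient-⋊-≅ : (X / Γ ∶ sg) ⋊ O ≅ quotient⋊ X O Γ sg
  quotient-⋊-≅ = record
    { hom = record
      { f      = λ p → p
      ; f-cong = λ { ((γ , γ∈Γ , xγ≈x') , y≈y') →
          liftAut X O γ , liftAut∈liftSub γ∈Γ , xγ≈x' , y≈y' }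
      ; f-r    = λ i → λ { (x , y) → ≈⇒sameOrbit
          (subst (_≈_ GX _) (act-quotient (η y i) x) (≈-refl GX) , ≈-refl GY) } }
    ; g      = λ p → p
    ; g-cong = λ { {x , y} (δ , (γ , γ∈Γ , δ≈γ) , xδ≈x' , yδ≈y') →
        let (xδ≈xγ , yδ≈y) = δ≈γ (x , y) in
          (γ , γ∈Γ , ≈-trans GX (≈-sym GX xδ≈xγ) xδ≈x')
        , ≈-trans GY (≈-sym GY yδ≈y) yδ≈y' }
    ; f∘g    = λ _ → ≈-refl (quotient⋊ X O Γ sg)
    ; g∘f    = λ _ → ≈-refl ((X / Γ ∶ sg) ⋊ O) }

theorem5p1 : ∀ {n m} (X X' : Premaniplex n) (O : VoltageOperator n m) →
  (Covers (Premaniplex.graph X) (Premaniplex.graph X') → Covers (X ⋊ O) (X' ⋊ O))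
  × (∀ (Γ : Aut (Premaniplex.graph X) → Set) (sg : IsSubgroup Γ) →
       Premaniplex.graph X' ≅ Premaniplex.graph (X / Γ ∶ sg) →
       (X' ⋊ O ≅ (X / Γ ∶ sg) ⋊ O) × ((X / Γ ∶ sg) ⋊ O ≅ quotient⋊ X O Γ sg))
theorem5p1 X X' O =
    ⋊-covering O
  , λ Γ sg X'≅X/Γ → ⋊-≅ O X'≅X/Γ , quotient-⋊-≅ X O Γ sg
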